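{- Let $\ell\ge 3$ be an integer divisible by $3$ and let $n$ be a positive integer divisible by $\ell/3$. Then there exists a locally $(3n/\ell)$-bounded edge-coloring $c$ of $K_n$ such that $K_n$ contains no $\ell$-vertex subgraph of diameter two that is properly colored by $c$.
   Context: An edge-coloring $c$ of $E(K_n)$ is locally $k$-bounded if for every vertex $v$, no color appears on more than $k$ of the edges incident to $v$. A subgraph is properly colored if no two of its edges sharing a vertex have the same color. A graph has diameter two if any two distinct vertices are adjacent or have a common neighbor, and it is not complete. -}

module Defs where

open import Data.Nat using (ℕ; _≤_; _*_; _/_; NonZero)
open import Data.Nat.Divisibility using (_∣_)
open import Data.Fin using (Fin)
open import Data.Fin.Subset using (Subset; _∈_; ∣_∣)
open import Data.Bool using (Bool; true; false)
open import Data.Product using (Σ; _×_; ∃; ∃-syntax)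
open import Data.Sum using (_⊎_)
open import Data.List using (List; length; filter)
open import Data.Fin using (Fin)
open import Data.List using (allFin)
open import Relation.Nullary using (¬_; Dec; _×-dec_; ¬?)
open import Relation.Binary.PropositionalEquality using (_≡_; _≢_)
import Data.Nat as ℕ
import Data.Fin as F

-- An edge-colouring of K_n: colour c u v of the edge {u,v} (u ≠ v),
-- colours are natural numbers; symmetric. Values on the diagonal are irrelevant.
record EdgeColouring (n : ℕ) : Set where
  field
    col : Fin n → Fin n → ℕ
    sym : ∀ u v → col u v ≡ col v u
open EdgeColouring public

degIn : ∀ {n} → EdgeColouring n → Fin n → ℕ → ℕ
degIn {n} c v a =
  length (filter (λ u → ¬? (u F.≟ v) ×-dec (col c v u ℕ.≟ a)) (allFin n))

LocallyBounded : ∀ {n} → ℕ → EdgeColouring n → Set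
LocallyBounded k c = ∀ v a → degIn c v a ≤ k

record Subgraph (n : ℕ) : Set where
  field
    V   : Subset n
    E   : Fin n → Fin n → Bool
    E-sym   : ∀ u v → E u v ≡ E v u
    E-irr   : ∀ u → E u u ≡ false
    E-inV   : ∀ u v → E u v ≡ true → (u ∈ V) × (v ∈ V)
open Subgraph public

Adj : ∀ {n} → Subgraph n → Fin n → Fin n → Set
Adj H u v = E H u v ≡ true

DiameterTwo : ∀ {n} → Subgraph n → Set
DiameterTwo H =
  (∀ u v → u ∈ V H → v ∈ V H → u ≢ v →
     Adj H u v ⊎ ∃[ w ] (Adj H u w × Adj H w v))
  × (∃[ u ] ∃[ v ] (u ∈ V H × v ∈ V H × u ≢ v × ¬ Adj H u v))

ProperlyColoured : ∀ {n} → EdgeColouring n → Subgraph n → Set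
ProperlyColoured c H =
  ∀ u v w → Adj H u v → Adj H u w → v ≢ w → col c u v ≢ col c u w

module Submission where

-- Write ℓ = 3q and n = Kq, so that 3n/ℓ = K.  Cut the vertex
-- set Fin n into q consecutive blocks of K vertices, block u = ⌊u/K⌋, and
-- colour the edge uv with block u + block v.
--   * Local boundedness: at v the colour a only occurs towards the block
--     a ∸ block v, which has at most K vertices.
--   * Let H be properly coloured and of diameter two.  Two vertices of H in
--     one block are adjacent, since a common neighbour w would see both in
--     the colour block w + block u.  Hence no block holds three vertices of
--     H: the first would see the other two in one colour.  So
--     |V(H)| ≤ 2q < 3q = ℓ.

open import Defs
open import Data.Nat using (ℕ; _≤_; _*_; _/_; NonZero)
open import Data.Nat.Divisibility using (_∣_)
open import Data.Fin.Subset using (∣_∣)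
open import Data.Product using (Σ; _×_; ∃; ∃-syntax)
open import Relation.Nullary using (¬_)
open import Relation.Binary.PropositionalEquality using (_≡_)

open import Data.Nat using (zero; suc; _+_; _∸_; _%_; _<_; z≤n; s≤s; _≟_; >-nonZero)
open import Data.Nat.Properties
open import Data.Nat.DivMod using (m≡m%n+[m/n]*n; m%n<n; m<n*o⇒m/o<n; m*n/n≡m)
open import Data.Nat.Divisibility using (divides)
open import Data.Fin using (Fin; toℕ) renaming (zero to fzero; suc to fsuc)
open import Data.Fin.Properties using (toℕ-injective; toℕ<n) renaming (suc-injective to fsuc-injective)
open import Data.Fin.Subset using (Subset; inside; outside) renaming (_∈_ to _∈ₛ_)
open import Data.Vec.Base as Vec using ([]; _∷_)
open import Data.List using (List; []; _∷_; length; filter; map; allFin)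
open import Data.List.Properties using (length-map)
open import Data.List.Membership.Propositional using (_∈_)
open import Data.List.Membership.Propositional.Properties using (∈-map⁻; ∈-filter⁻)
open import Data.List.Relation.Unary.Any using (here; there)
open import Data.List.Relation.Unary.All using (tabulate; _∷_)
open import Data.List.Relation.Unary.All.Properties using () renaming (map⁺ to all-map⁺)
open import Data.List.Relation.Unary.AllPairs using ([]; _∷_)
open import Data.List.Relation.Unary.Unique.Propositional using (Unique)
import Data.List.Relation.Unary.Unique.Propositional.Properties as Unique
open import Data.List.Relation.Binary.Sublist.Propositional.Properties
  using (filter⁺; filter-⊆; length-mono-≤)
open import Data.List.Relation.Binary.Sublist.Propositional using (⊆-refl)
open import Data.Product using (_,_; proj₁)
open import Data.Sum using (inj₁; inj₂)
open import Data.Empty using (⊥; ⊥-elim)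
open import Relation.Nullary using (yes; no; contradiction)
open import Relation.Unary using (Pred; Decidable)
open import Relation.Unary.Properties using (∁?)
open import Relation.Binary.PropositionalEquality
  using (refl; trans; cong; cong₂; subst; _≢_; module ≡-Reasoning)
  renaming (sym to ≡-sym)
open import Level using (0ℓ)

length-filter-split : ∀ {A : Set} {P : Pred A 0ℓ} (P? : Decidable P) xs →
  length xs ≡ length (filter P? xs) + length (filter (∁? P?) xs)
length-filter-split P? [] = refl
length-filter-split P? (x ∷ xs) with P? x
... | yes _ = cong suc (length-filter-split P? xs)
... | no  _ = trans (cong suc (length-filter-split P? xs))
                    (≡-sym (+-suc (length (filter P? xs)) (length (filter (∁? P?) xs))))

module _ {A : Set} (g : A → ℕ) where

  fibre : ℕ → List A → List A
  fibre t = filter (λ x → g x ≟ t)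

  ∈-fibre⁻ : ∀ t xs {x} → x ∈ fibre t xs → x ∈ xs × g x ≡ t
  ∈-fibre⁻ t xs = ∈-filter⁻ (λ x → g x ≟ t) {xs = xs}

  -- Induction on m
  -- splits off the fibre of the largest value m; the fibres of the rest are
  -- sublists of those of xs.
  pigeonhole : ∀ c m xs → (∀ {x} → x ∈ xs → g x < m) →
               (∀ t → length (fibre t xs) ≤ c) → length xs ≤ c * m
  pigeonhole c zero [] _ _ = z≤n
  pigeonhole c zero (x ∷ xs) below _ = contradiction (below (here refl)) λ ()
  pigeonhole c (suc m) xs below small = begin
      length xs                          ≡⟨ length-filter-split (λ x → g x ≟ m) xs ⟩
      length (fibre m xs) + length rest  ≤⟨ +-mono-≤ (small m) (pigeonhole c m rest rest-below rest-small) ⟩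
      c + c * m                          ≡⟨ ≡-sym (*-suc c m) ⟩
      c * suc m                          ∎
    where
    open ≤-Reasoning
    rest : List A
    rest = filter (∁? (λ x → g x ≟ m)) xs

    rest-below : ∀ {x} → x ∈ rest → g x < m
    rest-below x∈ with ∈-filter⁻ (∁? (λ x → g x ≟ m)) x∈
    ... | x∈xs , gx≢m = ≤∧≢⇒< (≤-pred (below x∈xs)) gx≢m

    rest-small : ∀ t → length (fibre t rest) ≤ c
    rest-small t =
      ≤-trans (length-mono-≤ (filter⁺ _ _ (λ { refl gx≡t → gx≡t }) (filter-⊆ _ xs))) (small t)

unique-length≤1 : ∀ {A : Set} {ys : List A} → Unique ys →
  (∀ {x y} → x ∈ ys → y ∈ ys → x ≡ y) → length ys ≤ 1
unique-length≤1 {ys = []} _ _ = z≤n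
unique-length≤1 {ys = _ ∷ []} _ _ = s≤s z≤n
unique-length≤1 {ys = _ ∷ _ ∷ _} ((a≢b ∷ _) ∷ _) equal =
  contradiction (equal (here refl) (there (here refl))) a≢b

unique-length≤2 : ∀ {A : Set} {ys : List A} → Unique ys →
  (∀ {x y z} → x ∈ ys → y ∈ ys → z ∈ ys → x ≢ y → x ≢ z → y ≢ z → ⊥) → length ys ≤ 2
unique-length≤2 {ys = []} _ _ = z≤n
unique-length≤2 {ys = _ ∷ []} _ _ = s≤s z≤n
unique-length≤2 {ys = _ ∷ _ ∷ []} _ _ = s≤s (s≤s z≤n)
unique-length≤2 {ys = _ ∷ _ ∷ _ ∷ _} ((a≢b ∷ a≢c ∷ _) ∷ (b≢c ∷ _) ∷ _) no-three =
  ⊥-elim (no-three (here refl) (there (here refl)) (there (there (here refl))) a≢b a≢c b≢c)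

members : ∀ {n} → Subset n → List (Fin n)
members [] = []
members (inside ∷ p) = fzero ∷ map fsuc (members p)
members (outside ∷ p) = map fsuc (members p)

members-length : ∀ {n} (p : Subset n) → length (members p) ≡ ∣ p ∣
members-length [] = refl
members-length (inside ∷ p) = cong suc (trans (length-map fsuc (members p)) (members-length p))
members-length (outside ∷ p) = trans (length-map fsuc (members p)) (members-length p)

members-sound : ∀ {n} (p : Subset n) {x} → x ∈ members p → x ∈ₛ p
members-sound (inside ∷ p) (here refl) = Vec.here
members-sound (inside ∷ p) (there x∈) with ∈-map⁻ fsuc x∈
... | y , y∈ , refl = Vec.there (members-sound p y∈)
members-sound (outside ∷ p) x∈ with ∈-map⁻ fsuc x∈
... | y , y∈ , refl = Vec.there (members-sound p y∈)

members-unique : ∀ {n} (p : Subset n) → Unique (members p)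
members-unique [] = []
members-unique (inside ∷ p) =
  all-map⁺ (tabulate (λ _ ())) ∷ Unique.map⁺ fsuc-injective (members-unique p)
members-unique (outside ∷ p) = Unique.map⁺ fsuc-injective (members-unique p)

module BlockColouring (K : ℕ) .{{_ : NonZero K}} where

  block : ∀ {n} → Fin n → ℕ
  block u = toℕ u / K

  colouring : ∀ n → EdgeColouring n
  colouring n = record
    { col = λ u v → block u + block v
    ; sym = λ u v → +-comm (block u) (block v)
    }

  -- A block has at most K vertices: within a block a vertex is determined by
  -- its remainder modulo K, which is below K.
  block-size : ∀ n t → length (fibre block t (allFin n)) ≤ K
  block-size n t = subst (length inBlock ≤_) (*-identityˡ K)
      (pigeonhole remainder 1 K inBlock (λ {u} _ → m%n<n (toℕ u) K) fibre-small)
    where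
    inBlock : List (Fin n)
    inBlock = fibre block t (allFin n)

    remainder : Fin n → ℕ
    remainder u = toℕ u % K

    fibre-small : ∀ s → length (fibre remainder s inBlock) ≤ 1
    fibre-small s =
      unique-length≤1 (Unique.filter⁺ _ (Unique.filter⁺ _ (Unique.allFin⁺ n))) equal
      where
      equal : ∀ {u v} → u ∈ fibre remainder s inBlock → v ∈ fibre remainder s inBlock → u ≡ v
      equal {u} {v} u∈ v∈
        with ∈-fibre⁻ remainder s inBlock u∈ | ∈-fibre⁻ remainder s inBlock v∈
      ... | u∈B , ru≡s | v∈B , rv≡s
        with ∈-fibre⁻ block t (allFin n) u∈B | ∈-fibre⁻ block t (allFin n) v∈B
      ... | _ , bu≡t | _ , bv≡t = toℕ-injective (begin
        toℕ u                      ≡⟨ m≡m%n+[m/n]*n (toℕ u) K ⟩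
        remainder u + block u * K  ≡⟨ cong₂ (λ r b → r + b * K) (trans ru≡s (≡-sym rv≡s))
                                                                 (trans bu≡t (≡-sym bv≡t)) ⟩
        remainder v + block v * K  ≡⟨ ≡-sym (m≡m%n+[m/n]*n (toℕ v) K) ⟩
        toℕ v                      ∎)
        where open ≡-Reasoning

  -- At v the colour a is used only towards the block a ∸ block v.
  locally-bounded : ∀ n → LocallyBounded K (colouring n)
  locally-bounded n v a =
    ≤-trans (length-mono-≤ (filter⁺ _ (λ u → block u ≟ a ∸ block v)
                              (λ { refl (_ , colour≡a) → towards colour≡a })
                              (⊆-refl {x = allFin n})))
            (block-size n (a ∸ block v))
    where
    towards : ∀ {u} → block v + block u ≡ a → block u ≡ a ∸ block v
    towards {u} colour≡a = ≡-sym (trans (cong (_∸ block v) (≡-sym colour≡a)) (m+n∸m≡n (block v) (block u)))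

  module _ {n} (H : Subgraph n) (diameter-two : DiameterTwo H)
           (proper : ProperlyColoured (colouring n) H) where

    -- Two vertices of H in one block are adjacent: a common neighbour would
    -- see both of them in the same colour.
    same-block-adjacent : ∀ {u v} → u ∈ₛ V H → v ∈ₛ V H → u ≢ v → block u ≡ block v → Adj H u v
    same-block-adjacent {u} {v} u∈ v∈ u≢v same with proj₁ diameter-two u v u∈ v∈ u≢v
    ... | inj₁ adjacent = adjacent
    ... | inj₂ (w , uw , wv) =
      contradiction (cong (block w +_) same) (proper w u v (trans (E-sym H w u) uw) wv u≢v)

    no-three-in-a-block : ∀ {x y z} → x ∈ₛ V H → y ∈ₛ V H → z ∈ₛ V H →
      x ≢ y → x ≢ z → y ≢ z → block x ≡ block y → block x ≡ block z → ⊥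
    no-three-in-a-block x∈ y∈ z∈ x≢y x≢z y≢z xy xz =
      proper _ _ _ (same-block-adjacent x∈ y∈ x≢y xy) (same-block-adjacent x∈ z∈ x≢z xz) y≢z
        (cong (block _ +_) (trans (≡-sym xy) xz))

    -- With n = K·q there are q blocks, each holding at most two vertices of H.
    at-most-two-per-block : ∀ q → n ≡ K * q → ∣ V H ∣ ≤ 2 * q
    at-most-two-per-block q n≡Kq = subst (_≤ 2 * q) (members-length (V H))
      (pigeonhole block 2 q H-vertices (λ {u} _ → block<q u) fibre-small)
      where
      H-vertices : List (Fin n)
      H-vertices = members (V H)

      block<q : ∀ u → block u < q
      block<q u = m<n*o⇒m/o<n (subst (toℕ u <_) (trans n≡Kq (*-comm K q)) (toℕ<n u))

      fibre-small : ∀ t → length (fibre block t H-vertices) ≤ 2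
      fibre-small t = unique-length≤2 (Unique.filter⁺ _ (members-unique (V H))) no-three
        where
        no-three : ∀ {x y z} → x ∈ fibre block t H-vertices → y ∈ fibre block t H-vertices →
                   z ∈ fibre block t H-vertices → x ≢ y → x ≢ z → y ≢ z → ⊥
        no-three x∈ y∈ z∈ x≢y x≢z y≢z
          with ∈-fibre⁻ block t H-vertices x∈ | ∈-fibre⁻ block t H-vertices y∈
             | ∈-fibre⁻ block t H-vertices z∈
        ... | x∈H , bx≡t | y∈H , by≡t | z∈H , bz≡t =
          no-three-in-a-block
            (members-sound (V H) x∈H) (members-sound (V H) y∈H) (members-sound (V H) z∈H)
            x≢y x≢z y≢z (trans bx≡t (≡-sym by≡t)) (trans bx≡t (≡-sym bz≡t))

record Parameters (ℓ n : ℕ) .{{_ : NonZero ℓ}} : Set where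
  field
    K q      : ℕ
    K≢0      : NonZero K
    n≡Kq     : n ≡ K * q
    3n/ℓ≡K   : (3 * n) / ℓ ≡ K
    2q<ℓ     : 2 * q < ℓ

parameters : ∀ ℓ n .{{_ : NonZero ℓ}} → 3 ≤ ℓ → 3 ∣ ℓ → 1 ≤ n → (ℓ / 3) ∣ n → Parameters ℓ n
parameters ℓ n 3≤ℓ (divides q ℓ≡q*3) 1≤n (divides K n≡K*ℓ/3) = record
  { K = K ; q = q ; K≢0 = K≢0 ; n≡Kq = n≡Kq ; 3n/ℓ≡K = 3n/ℓ≡K ; 2q<ℓ = 2q<ℓ }
  where
  n≡Kq : n ≡ K * q
  n≡Kq = trans n≡K*ℓ/3 (cong (K *_) (trans (cong (_/ 3) ℓ≡q*3) (m*n/n≡m q 3)))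

  K≢0 : NonZero K
  K≢0 = m*n≢0⇒m≢0 K {q} {{subst NonZero n≡Kq (>-nonZero 1≤n)}}

  q≢0 : NonZero q
  q≢0 = m*n≢0⇒m≢0 q {3} {{>-nonZero (subst (0 <_) ℓ≡q*3 (≤-trans (s≤s z≤n) 3≤ℓ))}}

  3n/ℓ≡K : (3 * n) / ℓ ≡ K
  3n/ℓ≡K = begin
    (3 * n) / ℓ        ≡⟨ cong (λ m → (3 * m) / ℓ) n≡Kq ⟩
    (3 * (K * q)) / ℓ  ≡⟨ cong (_/ ℓ) (*-comm 3 (K * q)) ⟩
    (K * q * 3) / ℓ    ≡⟨ cong (_/ ℓ) (*-assoc K q 3) ⟩
    (K * (q * 3)) / ℓ  ≡⟨ cong (λ m → (K * m) / ℓ) (≡-sym ℓ≡q*3) ⟩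
    (K * ℓ) / ℓ        ≡⟨ m*n/n≡m K ℓ ⟩
    K                  ∎
    where open ≡-Reasoning

  2q<ℓ : 2 * q < ℓ
  2q<ℓ = subst (2 * q <_) (trans (*-comm 3 q) (≡-sym ℓ≡q*3)) (*-monoˡ-< q {{q≢0}} {2} {3} ≤-refl)

lemma4p3 : (ℓ n : ℕ) → .{{_ : NonZero ℓ}} → 3 ≤ ℓ → 3 ∣ ℓ → 1 ≤ n → (ℓ / 3) ∣ n →
    ∃[ c ] (LocallyBounded ((3 * n) / ℓ) c
      × ((H : Subgraph n) → ∣ V H ∣ ≡ ℓ → DiameterTwo H → ¬ ProperlyColoured c H))
lemma4p3 ℓ n 3≤ℓ 3∣ℓ 1≤n ℓ/3∣n =
  colouring n
  , subst (λ k → LocallyBounded k (colouring n)) (≡-sym 3n/ℓ≡K) (locally-bounded n)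
  , too-small
  where
  open Parameters (parameters ℓ n 3≤ℓ 3∣ℓ 1≤n ℓ/3∣n)
  open BlockColouring K {{K≢0}}

  too-small : (H : Subgraph n) → ∣ V H ∣ ≡ ℓ → DiameterTwo H → ¬ ProperlyColoured (colouring n) H
  too-small H |H|≡ℓ diameter-two proper =
    <⇒≱ 2q<ℓ (subst (_≤ 2 * q) |H|≡ℓ (at-most-two-per-block H diameter-two proper q n≡Kq))
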